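{- Let $p$ be a prime and $n$ a positive integer not divisible by $p$. Then $|\tilde\sigma_p(n)|\ge n\,(1/2)^{\omega(n)}$, where $\omega(n)$ is the number of distinct prime factors of $n$.
   Context: $\left(\frac{p}{\cdot}\right)$ is the Kronecker symbol and $\tilde\sigma_p(n)=\sum_{0<d\mid n}\left(\frac pd\right)d$ for $n>0$. -}

module Defs where

open import Data.Nat as ℕ using (ℕ; zero; suc; _%_; _/_; _^_; _≡ᵇ_)
open import Data.Nat.Divisibility using (_∣?_)
open import Data.Nat.Primality using (prime?)
open import Data.Integer as ℤ using (ℤ; +_; -[1+_])
open import Data.List using (List; []; _∷_; filter; map; upTo; length; foldr)
open import Data.Bool.ListAction using (any)
open import Data.Bool using (Bool; true; false; if_then_else_)
open import Relation.Nullary.Decidable using (⌊_⌋)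

range1 : ℕ → List ℕ
range1 n = map suc (upTo n)

legendre : ℕ → ℕ → ℤ
legendre a zero = + 0
legendre a q@(suc _) =
  if (a % q) ≡ᵇ 0 then + 0
  else if any (λ x → ((x ℕ.* x) % q) ≡ᵇ (a % q)) (upTo q) then + 1
  else -[1+ 0 ]

kronecker2 : ℕ → ℤ
kronecker2 a =
  if (a % 2) ≡ᵇ 0 then + 0
  else if ((a % 8) ≡ᵇ 1) Data.Bool.∨ ((a % 8) ≡ᵇ 7) then + 1
  else -[1+ 0 ]

kroneckerPrime : ℕ → ℕ → ℤ
kroneckerPrime a q = if q ≡ᵇ 2 then kronecker2 a else legendre a q

-- q-adic valuation of d (for q ≥ 2, d > 0), computed with fuel d.
valuationFuel : ℕ → ℕ → ℕ → ℕ
valuationFuel zero q d = 0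
valuationFuel (suc f) zero d = 0
valuationFuel (suc f) q@(suc _) d =
  if (d ≡ᵇ 0) then 0
  else if ⌊ q ∣? d ⌋ then suc (valuationFuel f q (d / q)) else 0

valuation : ℕ → ℕ → ℕ
valuation q d = valuationFuel d q d

primesUpTo : ℕ → List ℕ
primesUpTo d = filter (λ q → prime? q) (range1 d)

kronecker : ℕ → ℕ → ℤ
kronecker a d = foldr (λ q acc → (kroneckerPrime a q ℤ.^ valuation q d) ℤ.* acc) (+ 1) (primesUpTo d)

divisors : ℕ → List ℕ
divisors n = filter (λ d → d ∣? n) (range1 n)

sigmaTilde : ℕ → ℕ → ℤ
sigmaTilde p n = foldr (λ d acc → kronecker p d ℤ.* (+ d) ℤ.+ acc) (+ 0) (divisors n)

omega : ℕ → ℕ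
omega n = length (filter (λ q → q ∣? n) (primesUpTo n))

{-# OPTIONS --safe #-}
-- Since (p/·) is completely multiplicative, σ̃_p is multiplicative along prime powers:
-- for a prime q ∤ m, σ̃_p(q^e m) = σ̃_p(m) (1 + x + ⋯ + x^e) with x = (p/q) q.
-- When q ∤ p we have |x| = q, and (x − 1)(1 + ⋯ + x^e) = x^(e+1) − 1 with |x − 1| ≤ q + 1
-- gives |1 + ⋯ + x^e| ≥ q^e / 2. Stripping one prime power from n at a time thus costs at
-- most a factor 2 per distinct prime factor, which is the bound by induction on n.
module Submission where

open import Algebra.Bundles using (CommutativeSemigroup)
open import Algebra.Structures using (IsCommutativeMonoid)
open import Data.Bool using (true; false; if_then_else_)
open import Data.Integer as ℤ using (ℤ; +_; -[1+_]; ∣_∣)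
import Data.Integer.Properties as ℤₚ
open import Data.Integer.Tactic.RingSolver using (solve-∀)
open import Data.List using (List; []; _∷_; _++_; [_]; map; upTo; foldr; filter; length)
import Data.List.Properties as List
open import Data.Nat as ℕ
  using (ℕ; zero; suc; _+_; _*_; _^_; _∸_; _≤_; _<_; _/_; _≡ᵇ_; z≤n; s≤s; z<s; NonZero)
open import Data.Nat.Coprimality using (Coprime; coprime-divisor)
open import Data.Nat.Divisibility
open import Data.Nat.DivMod
open import Data.Nat.Induction using (<-wellFounded)
open import Data.Nat.Primality
open import Data.Nat.Properties
import Data.Nat.Tactic.RingSolver as ℕ-Solver
open import Data.Product using (∃-syntax; _×_; _,_)
open import Data.Sum using (inj₁; inj₂)
open import Function using (_∘_)
open import Induction.WellFounded using (Acc; acc)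
open import Level using (0ℓ)
open import Relation.Nullary using (¬_; yes; no; does)
open import Relation.Nullary.Decidable using (dec-true; dec-false)
open import Relation.Nullary.Negation using (contradiction)
open import Relation.Unary using (Pred; Decidable)
open import Relation.Binary.PropositionalEquality hiding ([_])

open import Defs

prime⇒>1 : ∀ {q} → Prime q → 1 < q
prime⇒>1 {q} pq = ℕ.nonTrivial⇒n>1 q {{prime⇒nonTrivial pq}}

valuationFuel-irrelevant : ∀ {q} f f' d → 1 < q → d ≤ f → d ≤ f' →
  valuationFuel f q d ≡ valuationFuel f' q d
valuationFuel-irrelevant zero    zero     zero    _ _ _ = refl
valuationFuel-irrelevant zero    (suc _)  zero    (s≤s _) _ _ = refl
valuationFuel-irrelevant (suc _) zero     zero    (s≤s _) _ _ = refl
valuationFuel-irrelevant (suc _) (suc _)  zero    (s≤s _) _ _ = refl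
valuationFuel-irrelevant {q@(suc _)} (suc f) (suc f') (suc d) 1<q (s≤s d≤f) (s≤s d≤f')
  with q ∣? suc d
... | no _  = refl
... | yes _ = cong suc (valuationFuel-irrelevant f f' (suc d / q) 1<q
                (≤-trans d/q<d d≤f) (≤-trans d/q<d d≤f'))
  where
  d/q<d : suc d / q ≤ d
  d/q<d = <⇒≤pred (m/n<m (suc d) q 1<q)

valuation-∣ : ∀ {q d} .{{_ : NonZero q}} .{{_ : NonZero d}} → 1 < q → q ∣ d →
  valuation q d ≡ suc (valuation q (d / q))
valuation-∣ {q@(suc _)} {suc d} 1<q q∣d with q ∣? suc d
... | yes _   = cong suc (valuationFuel-irrelevant d (suc d / q) (suc d / q) 1<q
                  (<⇒≤pred (m/n<m (suc d) q 1<q)) ≤-refl)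
... | no q∤d = contradiction q∣d q∤d

valuation-∤ : ∀ {q d} → ¬ q ∣ d → valuation q d ≡ 0
valuation-∤ {zero}      {zero}  _ = refl
valuation-∤ {zero}      {suc d} _ = refl
valuation-∤ {suc _}     {zero}  _ = refl
valuation-∤ {q@(suc _)} {suc d} q∤d with q ∣? suc d
... | yes q∣d = contradiction q∣d q∤d
... | no _    = refl

valuation-< : ∀ {q d} .{{_ : NonZero d}} → d < q → valuation q d ≡ 0
valuation-< d<q = valuation-∤ (λ q∣d → <⇒≱ d<q (∣⇒≤ q∣d))

prime∣prime⇒≡ : ∀ {r q} → Prime r → Prime q → r ∣ q → r ≡ q
prime∣prime⇒≡ pr pq r∣q with prime⇒irreducible pq r∣q
... | inj₂ r≡q  = r≡q
... | inj₁ refl = contradiction pr ¬prime[1]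

valuation-q* : ∀ {q} d → Prime q → .{{_ : NonZero d}} → valuation q (q * d) ≡ suc (valuation q d)
valuation-q* {q} d pq = begin
  valuation q (q * d)            ≡⟨ valuation-∣ (prime⇒>1 pq) (m∣m*n d) ⟩
  suc (valuation q (q * d / q))  ≡⟨ cong (λ x → suc (valuation q (x / q))) (*-comm q d) ⟩
  suc (valuation q (d * q / q))  ≡⟨ cong (suc ∘ valuation q) (m*n/n≡m d q) ⟩
  suc (valuation q d)            ∎
  where
  open ≡-Reasoning
  instance _ = prime⇒nonZero pq
  instance _ = m*n≢0 q d

valuation-p* : ∀ {r q} d → Prime r → Prime q → r ≢ q → .{{_ : NonZero d}} →
  valuation r (q * d) ≡ valuation r d
valuation-p* {r} {q} d pr pq r≢q = go d (<-wellFounded d)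
  where
  instance _ = prime⇒nonZero pr
  instance _ = prime⇒nonZero pq
  1<r : 1 < r
  1<r = prime⇒>1 pr
  r∤q : ¬ r ∣ q
  r∤q r∣q = r≢q (prime∣prime⇒≡ pr pq r∣q)
  go : ∀ d .{{_ : NonZero d}} → Acc _<_ d → valuation r (q * d) ≡ valuation r d
  go d (acc rec) with r ∣? d
  ... | yes r∣d = begin
    valuation r (q * d)             ≡⟨ valuation-∣ {{_}} {{m*n≢0 q d}} 1<r (∣-trans r∣d (n∣m*n q)) ⟩
    suc (valuation r (q * d / r))   ≡⟨ cong (suc ∘ valuation r) (*-/-assoc q r∣d) ⟩
    suc (valuation r (q * (d / r))) ≡⟨ cong suc (go (d / r) {{d/r≢0}} (rec (m/n<m d r 1<r))) ⟩
    suc (valuation r (d / r))       ≡⟨ valuation-∣ 1<r r∣d ⟨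
    valuation r d                   ∎
    where
    open ≡-Reasoning
    d/r≢0 : NonZero (d / r)
    d/r≢0 = ℕ.>-nonZero (m≥n⇒m/n>0 (∣⇒≤ r∣d))
  ... | no r∤d = trans (valuation-∤ r∤qd) (sym (valuation-∤ r∤d))
    where
    r∤qd : ¬ r ∣ q * d
    r∤qd r∣qd with euclidsLemma q d pr r∣qd
    ... | inj₁ r∣q = r∤q r∣q
    ... | inj₂ r∣d = r∤d r∣d

module RangeFold {A : Set} {_∙_ : A → A → A} {ε : A}
                 (isCM : IsCommutativeMonoid _≡_ _∙_ ε) where

  open IsCommutativeMonoid isCM using (assoc; identityˡ; identityʳ; isCommutativeSemigroup)

  commutativeSemigroup : CommutativeSemigroup 0ℓ 0ℓ
  commutativeSemigroup = record { isCommutativeSemigroup = isCommutativeSemigroup }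

  open import Algebra.Properties.CommutativeSemigroup commutativeSemigroup using (interchange)
  open ≡-Reasoning

  fold : (ℕ → A) → List ℕ → A
  fold h = foldr (λ d acc → h d ∙ acc) ε

  foldRange : (ℕ → A) → ℕ → A
  foldRange h zero    = ε
  foldRange h (suc N) = foldRange h N ∙ h (suc N)

  fold-++ : ∀ h xs ys → fold h (xs ++ ys) ≡ fold h xs ∙ fold h ys
  fold-++ h []       ys = sym (identityˡ _)
  fold-++ h (x ∷ xs) ys = trans (cong (h x ∙_) (fold-++ h xs ys)) (sym (assoc _ _ _))

  fold-filter : ∀ {p} {P : Pred ℕ p} (P? : Decidable P) h xs →
    fold h (filter P? xs) ≡ fold (λ d → if does (P? d) then h d else ε) xs
  fold-filter P? h []       = refl
  fold-filter P? h (x ∷ xs) with does (P? x)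
  ... | true  = cong (h x ∙_) (fold-filter P? h xs)
  ... | false = trans (fold-filter P? h xs) (sym (identityˡ _))

  fold-range1 : ∀ h N → fold h (range1 N) ≡ foldRange h N
  fold-range1 h zero    = refl
  fold-range1 h (suc N) = begin
    fold h (map suc (upTo (suc N)))        ≡⟨ cong (fold h ∘ map suc) (List.upTo-∷ʳ N) ⟨
    fold h (map suc (upTo N ++ [ N ]))     ≡⟨ cong (fold h) (List.map-++ suc (upTo N) [ N ]) ⟩
    fold h (range1 N ++ [ suc N ])         ≡⟨ fold-++ h (range1 N) [ suc N ] ⟩
    fold h (range1 N) ∙ (h (suc N) ∙ ε)    ≡⟨ cong₂ _∙_ (fold-range1 h N) (identityʳ _) ⟩
    foldRange h N ∙ h (suc N)              ∎

  foldRange-cong : ∀ h h' N → (∀ i → i < N → h (suc i) ≡ h' (suc i)) →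
    foldRange h N ≡ foldRange h' N
  foldRange-cong h h' zero    _  = refl
  foldRange-cong h h' (suc N) eq =
    cong₂ _∙_ (foldRange-cong h h' N (λ i i<N → eq i (m<n⇒m<1+n i<N))) (eq N ≤-refl)

  foldRange-ε : ∀ h N → (∀ i → i < N → h (suc i) ≡ ε) → foldRange h N ≡ ε
  foldRange-ε h N eq = trans (foldRange-cong h (λ _ → ε) N eq) (foldRange-const N)
    where
    foldRange-const : ∀ N → foldRange (λ _ → ε) N ≡ ε
    foldRange-const zero    = refl
    foldRange-const (suc N) = trans (identityʳ _) (foldRange-const N)

  foldRange-∙ : ∀ h h' N → foldRange (λ j → h j ∙ h' j) N ≡ foldRange h N ∙ foldRange h' N
  foldRange-∙ h h' zero    = sym (identityˡ ε)
  foldRange-∙ h h' (suc N) =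
    trans (cong (_∙ (h (suc N) ∙ h' (suc N))) (foldRange-∙ h h' N)) (interchange _ _ _ _)

  foldRange-+ : ∀ h a b → foldRange h (a + b) ≡ foldRange h a ∙ foldRange (λ j → h (a + j)) b
  foldRange-+ h a zero    = trans (cong (foldRange h) (+-identityʳ a)) (sym (identityʳ _))
  foldRange-+ h a (suc b) = begin
    foldRange h (a + suc b)
      ≡⟨ cong (foldRange h) (+-suc a b) ⟩
    foldRange h (a + b) ∙ h (suc (a + b))
      ≡⟨ cong₂ _∙_ (foldRange-+ h a b) (cong h (sym (+-suc a b))) ⟩
    (foldRange h a ∙ foldRange (λ j → h (a + j)) b) ∙ h (a + suc b)
      ≡⟨ assoc _ _ _ ⟩
    foldRange h a ∙ foldRange (λ j → h (a + j)) (suc b)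
      ∎

  foldRange-extend : ∀ h a N → a ≤ N → (∀ j → a < j → h j ≡ ε) → foldRange h N ≡ foldRange h a
  foldRange-extend h a N a≤N vanish = begin
    foldRange h N                                          ≡⟨ cong (foldRange h) (m+[n∸m]≡n a≤N) ⟨
    foldRange h (a + (N ∸ a))                              ≡⟨ foldRange-+ h a (N ∸ a) ⟩
    foldRange h a ∙ foldRange (λ j → h (a + j)) (N ∸ a)    ≡⟨ cong (foldRange h a ∙_) tail≡ε ⟩
    foldRange h a ∙ ε                                      ≡⟨ identityʳ _ ⟩
    foldRange h a                                          ∎
    where
    tail≡ε : foldRange (λ j → h (a + j)) (N ∸ a) ≡ ε
    tail≡ε = foldRange-ε _ (N ∸ a) (λ i _ → vanish (a + suc i) (m<m+n a z<s))

  foldRange-single : ∀ h q N → 1 ≤ q → q ≤ N → (∀ i → i < N → suc i ≢ q → h (suc i) ≡ ε) →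
    foldRange h N ≡ h q
  foldRange-single h q zero    1≤q q≤0 _ = contradiction (≤-trans 1≤q q≤0) λ ()
  foldRange-single h q (suc N) 1≤q q≤N vanish with q ≟ suc N
  ... | yes refl = trans (cong (_∙ h q) (foldRange-ε h N below-q)) (identityˡ _)
    where
    below-q : ∀ i → i < N → h (suc i) ≡ ε
    below-q i i<N = vanish i (m<n⇒m<1+n i<N) (<⇒≢ (s≤s i<N))
  ... | no q≢1+N = trans (cong₂ _∙_ up-to-N (vanish N ≤-refl (q≢1+N ∘ sym))) (identityʳ _)
    where
    up-to-N : foldRange h N ≡ h q
    up-to-N = foldRange-single h q N 1≤q (≤-pred (≤∧≢⇒< q≤N q≢1+N))
                (λ i i<N → vanish i (m<n⇒m<1+n i<N))

  foldRange-multiples : ∀ h q K → 1 ≤ q →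
    foldRange (λ d → if does (q ∣? d) then h d else ε) (q * K) ≡ foldRange (λ d → h (q * d)) K
  foldRange-multiples h q zero    _   = cong (foldRange _) (*-zeroʳ q)
  foldRange-multiples h q (suc K) 1≤q = begin
    foldRange h∣ (q * suc K)
      ≡⟨ cong (foldRange h∣) q[1+K]≡qK+q ⟩
    foldRange h∣ (q * K + q)
      ≡⟨ foldRange-+ h∣ (q * K) q ⟩
    foldRange h∣ (q * K) ∙ foldRange (λ j → h∣ (q * K + j)) q
      ≡⟨ cong₂ _∙_ (foldRange-multiples h q K 1≤q) block ⟩
    foldRange (λ d → h (q * d)) K ∙ h (q * suc K)
      ∎
    where
    h∣ : ℕ → A
    h∣ d = if does (q ∣? d) then h d else ε
    q[1+K]≡qK+q : q * suc K ≡ q * K + q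
    q[1+K]≡qK+q = trans (*-suc q K) (+-comm q (q * K))
    only-last-multiple : ∀ i → i < q → suc i ≢ q → h∣ (q * K + suc i) ≡ ε
    only-last-multiple i i<q i+1≢q with q ∣? (q * K + suc i)
    ... | no _    = refl
    ... | yes q∣· = contradiction (≤-antisym i<q (∣⇒≤ (∣m+n∣m⇒∣n q∣· (m∣m*n K)))) i+1≢q
    last-multiple : h∣ (q * K + q) ≡ h (q * suc K)
    last-multiple with q ∣? (q * K + q)
    ... | yes _   = cong h (sym q[1+K]≡qK+q)
    ... | no q∤· = contradiction (∣m∣n⇒∣m+n (m∣m*n K) ∣-refl) q∤·
    block : foldRange (λ j → h∣ (q * K + j)) q ≡ h (q * suc K)
    block = trans (foldRange-single _ q q 1≤q ≤-refl only-last-multiple) last-multiple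

module Σℤ = RangeFold ℤₚ.+-0-isCommutativeMonoid
module Πℤ = RangeFold ℤₚ.*-1-isCommutativeMonoid
module Σℕ = RangeFold +-0-isCommutativeMonoid

kroneckerFactor : ℕ → ℕ → ℕ → ℤ
kroneckerFactor a d r = if does (prime? r) then kroneckerPrime a r ℤ.^ valuation r d else + 1

kronecker≡foldRange : ∀ a d → kronecker a d ≡ Πℤ.foldRange (kroneckerFactor a d) d
kronecker≡foldRange a d =
  trans (Πℤ.fold-filter (λ r → prime? r) _ (range1 d)) (Πℤ.fold-range1 (kroneckerFactor a d) d)

kronecker-prime* : ∀ a q d → Prime q → .{{_ : NonZero d}} →
  kronecker a (q * d) ≡ kroneckerPrime a q ℤ.* kronecker a d
kronecker-prime* a q d pq = begin
  kronecker a (q * d)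
    ≡⟨ kronecker≡foldRange a (q * d) ⟩
  Πℤ.foldRange (kroneckerFactor a (q * d)) (q * d)
    ≡⟨ Πℤ.foldRange-cong _ _ (q * d) (λ i _ → factor-q* (suc i)) ⟩
  Πℤ.foldRange (λ r → atq r ℤ.* kroneckerFactor a d r) (q * d)
    ≡⟨ Πℤ.foldRange-∙ atq _ (q * d) ⟩
  Πℤ.foldRange atq (q * d) ℤ.* Πℤ.foldRange (kroneckerFactor a d) (q * d)
    ≡⟨ cong₂ ℤ._*_ (trans (Πℤ.foldRange-single atq q (q * d) 1≤q (m≤m*n q d) atq-elsewhere) atq-q)
                   (Πℤ.foldRange-extend _ d (q * d) (m≤n*m d q) factor>d) ⟩
  kroneckerPrime a q ℤ.* Πℤ.foldRange (kroneckerFactor a d) d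
    ≡⟨ cong (kroneckerPrime a q ℤ.*_) (kronecker≡foldRange a d) ⟨
  kroneckerPrime a q ℤ.* kronecker a d
    ∎
  where
  open ≡-Reasoning
  instance _ = prime⇒nonZero pq
  1≤q : 1 ≤ q
  1≤q = ℕ.>-nonZero⁻¹ q
  atq : ℕ → ℤ
  atq r = if does (r ≟ q) then kroneckerPrime a q else + 1
  atq-q : atq q ≡ kroneckerPrime a q
  atq-q rewrite dec-true (q ≟ q) refl = refl
  atq-elsewhere : ∀ i → i < q * d → suc i ≢ q → atq (suc i) ≡ + 1
  atq-elsewhere i _ i+1≢q rewrite dec-false (suc i ≟ q) i+1≢q = refl
  factor>d : ∀ r → d < r → kroneckerFactor a d r ≡ + 1
  factor>d r d<r with prime? r
  ... | no _   = refl
  ... | yes pr = cong (kroneckerPrime a r ℤ.^_) (valuation-< d<r)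
  factor-q* : ∀ r → kroneckerFactor a (q * d) r ≡ atq r ℤ.* kroneckerFactor a d r
  factor-q* r with prime? r | r ≟ q
  ... | no ¬pr | yes refl = contradiction pq ¬pr
  ... | no _   | no r≢q   rewrite dec-false (r ≟ q) r≢q = refl
  ... | yes pr | yes refl rewrite dec-true (r ≟ r) refl = cong (kroneckerPrime a r ℤ.^_) (valuation-q* d pr)
  ... | yes pr | no r≢q   rewrite dec-false (r ≟ q) r≢q =
    trans (cong (kroneckerPrime a r ℤ.^_) (valuation-p* d pr pq r≢q)) (sym (ℤₚ.*-identityˡ _))

prime∤⇒coprime : ∀ {q d} → Prime q → ¬ q ∣ d → Coprime d q
prime∤⇒coprime pq q∤d (c∣d , c∣q) with prime⇒irreducible pq c∣q
... | inj₁ c≡1 = c≡1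
... | inj₂ refl = contradiction c∣d q∤d

∣q^k*m⇒∣m : ∀ {q d m} → Prime q → ¬ q ∣ d → ∀ k → d ∣ q ^ k * m → d ∣ m
∣q^k*m⇒∣m {q} {d} {m} pq q∤d zero    d∣m = subst (d ∣_) (*-identityˡ m) d∣m
∣q^k*m⇒∣m {q} {d} {m} pq q∤d (suc k) d∣· =
  ∣q^k*m⇒∣m pq q∤d k (coprime-divisor (prime∤⇒coprime pq q∤d) (subst (d ∣_) (*-assoc q (q ^ k) m) d∣·))

divisorSum : (ℕ → ℤ) → ℕ → ℤ
divisorSum f n = Σℤ.fold f (divisors n)

onDivisors : (ℕ → ℤ) → ℕ → ℕ → ℤ
onDivisors f n d = if does (d ∣? n) then f d else + 0

divisorSum≡foldRange : ∀ f n → divisorSum f n ≡ Σℤ.foldRange (onDivisors f n) n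
divisorSum≡foldRange f n = trans (Σℤ.fold-filter (λ d → d ∣? n) f (range1 n)) (Σℤ.fold-range1 _ n)

Σℤ-distribˡ : ∀ x h N → Σℤ.foldRange (λ j → x ℤ.* h j) N ≡ x ℤ.* Σℤ.foldRange h N
Σℤ-distribˡ x h zero    = sym (ℤₚ.*-zeroʳ x)
Σℤ-distribˡ x h (suc N) =
  trans (cong (ℤ._+ x ℤ.* h (suc N)) (Σℤ-distribˡ x h N)) (sym (ℤₚ.*-distribˡ-+ x _ _))

divisorSum-split : ∀ f c q m M → Prime q → (∀ d → .{{_ : NonZero d}} → f (q * d) ≡ c ℤ.* f d) →
  ¬ q ∣ m → .{{_ : NonZero m}} → .{{_ : NonZero M}} → m ∣ M →
  (∀ d → ¬ q ∣ d → d ∣ q * M → d ∣ m) →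
  divisorSum f (q * M) ≡ divisorSum f m ℤ.+ c ℤ.* divisorSum f M
divisorSum-split f c q m M pq f-q* q∤m m∣M q-free⇒∣m = begin
  divisorSum f (q * M)
    ≡⟨ divisorSum≡foldRange f (q * M) ⟩
  Σℤ.foldRange (onDivisors f (q * M)) (q * M)
    ≡⟨ Σℤ.foldRange-cong _ _ (q * M) (λ i _ → split (suc i)) ⟩
  Σℤ.foldRange (λ d → onDivisors f m d ℤ.+ qPart d) (q * M)
    ≡⟨ Σℤ.foldRange-∙ (onDivisors f m) qPart (q * M) ⟩
  Σℤ.foldRange (onDivisors f m) (q * M) ℤ.+ Σℤ.foldRange qPart (q * M)
    ≡⟨ cong₂ ℤ._+_ (Σℤ.foldRange-extend _ m (q * M) m≤qM above-m)
                   (Σℤ.foldRange-multiples (onDivisors f (q * M)) q M 1≤q) ⟩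
  Σℤ.foldRange (onDivisors f m) m ℤ.+ Σℤ.foldRange (λ d → onDivisors f (q * M) (q * d)) M
    ≡⟨ cong₂ ℤ._+_ (sym (divisorSum≡foldRange f m))
                   (Σℤ.foldRange-cong _ _ M (λ i _ → onDivisors-q* (suc i))) ⟩
  divisorSum f m ℤ.+ Σℤ.foldRange (λ d → c ℤ.* onDivisors f M d) M
    ≡⟨ cong (ℤ._+_ (divisorSum f m))
            (trans (Σℤ-distribˡ c _ M) (cong (c ℤ.*_) (sym (divisorSum≡foldRange f M)))) ⟩
  divisorSum f m ℤ.+ c ℤ.* divisorSum f M
    ∎
  where
  open ≡-Reasoning
  instance _ = prime⇒nonZero pq
  1≤q : 1 ≤ q
  1≤q = ℕ.>-nonZero⁻¹ q
  m≤qM : m ≤ q * M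
  m≤qM = ≤-trans (∣⇒≤ m∣M) (m≤n*m M q)
  qPart : ℕ → ℤ
  qPart d = if does (q ∣? d) then onDivisors f (q * M) d else + 0
  split : ∀ d → onDivisors f (q * M) d ≡ onDivisors f m d ℤ.+ qPart d
  split d with q ∣? d
  split d | yes q∣d with d ∣? m
  ... | yes d∣m = contradiction (∣-trans q∣d d∣m) q∤m
  ... | no _    = sym (ℤₚ.+-identityˡ _)
  split d | no q∤d with d ∣? (q * M) | d ∣? m
  ... | yes _     | yes _   = sym (ℤₚ.+-identityʳ _)
  ... | no _      | no _    = refl
  ... | yes d∣qM  | no d∤m  = contradiction (q-free⇒∣m d q∤d d∣qM) d∤m
  ... | no d∤qM   | yes d∣m = contradiction (∣-trans d∣m (∣-trans m∣M (n∣m*n q))) d∤qM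
  above-m : ∀ j → m < j → onDivisors f m j ≡ + 0
  above-m j m<j with j ∣? m
  ... | no _    = refl
  ... | yes j∣m = contradiction (∣⇒≤ j∣m) (<⇒≱ m<j)
  onDivisors-q* : ∀ d .{{_ : NonZero d}} → onDivisors f (q * M) (q * d) ≡ c ℤ.* onDivisors f M d
  onDivisors-q* d with (q * d) ∣? (q * M) | d ∣? M
  ... | yes _       | yes _    = f-q* d
  ... | no _        | no _     = sym (ℤₚ.*-zeroʳ c)
  ... | yes qd∣qM   | no d∤M   = contradiction (*-cancelˡ-∣ q qd∣qM) d∤M
  ... | no qd∤qM    | yes d∣M  = contradiction (*-monoʳ-∣ q d∣M) qd∤qM

geom : ℤ → ℕ → ℤ
geom x zero    = + 1
geom x (suc k) = + 1 ℤ.+ x ℤ.* geom x k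

divisorSum-prime^ : ∀ f c q m → Prime q → (∀ d → .{{_ : NonZero d}} → f (q * d) ≡ c ℤ.* f d) →
  ¬ q ∣ m → .{{_ : NonZero m}} → ∀ k → divisorSum f (q ^ k * m) ≡ divisorSum f m ℤ.* geom c k
divisorSum-prime^ f c q m pq f-q* q∤m zero =
  trans (cong (divisorSum f) (*-identityˡ m)) (sym (ℤₚ.*-identityʳ _))
divisorSum-prime^ f c q m pq f-q* q∤m (suc k) = begin
  divisorSum f (q * q ^ k * m)
    ≡⟨ cong (divisorSum f) (*-assoc q (q ^ k) m) ⟩
  divisorSum f (q * M)
    ≡⟨ divisorSum-split f c q m M pq f-q* q∤m (n∣m*n (q ^ k)) q-free⇒∣m ⟩
  divisorSum f m ℤ.+ c ℤ.* divisorSum f M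
    ≡⟨ cong (λ s → divisorSum f m ℤ.+ c ℤ.* s) (divisorSum-prime^ f c q m pq f-q* q∤m k) ⟩
  divisorSum f m ℤ.+ c ℤ.* (divisorSum f m ℤ.* geom c k)
    ≡⟨ factor-s (divisorSum f m) c (geom c k) ⟩
  divisorSum f m ℤ.* geom c (suc k)
    ∎
  where
  open ≡-Reasoning
  instance _ = prime⇒nonZero pq
  M : ℕ
  M = q ^ k * m
  instance _ = m*n≢0 (q ^ k) m {{m^n≢0 q k}}
  factor-s : ∀ s c g → s ℤ.+ c ℤ.* (s ℤ.* g) ≡ s ℤ.* (+ 1 ℤ.+ c ℤ.* g)
  factor-s = solve-∀
  q-free⇒∣m : ∀ d → ¬ q ∣ d → d ∣ q * M → d ∣ m
  q-free⇒∣m d q∤d d∣qM = ∣q^k*m⇒∣m pq q∤d (suc k) (subst (d ∣_) (sym (*-assoc q (q ^ k) m)) d∣qM)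

sigmaTilde-prime^ : ∀ p q m → Prime q → ¬ q ∣ m → .{{_ : NonZero m}} → ∀ k →
  sigmaTilde p (q ^ k * m) ≡ sigmaTilde p m ℤ.* geom (kroneckerPrime p q ℤ.* + q) k
sigmaTilde-prime^ p q m pq = divisorSum-prime^ (λ d → kronecker p d ℤ.* + d) _ q m pq term-q*
  where
  rearrange : ∀ χ κ q d → (χ ℤ.* κ) ℤ.* (q ℤ.* d) ≡ (χ ℤ.* q) ℤ.* (κ ℤ.* d)
  rearrange = solve-∀
  term-q* : ∀ d .{{_ : NonZero d}} →
    kronecker p (q * d) ℤ.* + (q * d) ≡ (kroneckerPrime p q ℤ.* + q) ℤ.* (kronecker p d ℤ.* + d)
  term-q* d = trans (cong₂ ℤ._*_ (kronecker-prime* p q d pq) (ℤₚ.pos-* q d))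
                    (rearrange (kroneckerPrime p q) (kronecker p d) (+ q) (+ d))

∣0-or-±1∣≡1 : ∀ {r} → r ≢ 0 → ∀ b → ∣ (if r ≡ᵇ 0 then + 0 else if b then + 1 else -[1+ 0 ]) ∣ ≡ 1
∣0-or-±1∣≡1 {zero}  r≢0 _     = contradiction refl r≢0
∣0-or-±1∣≡1 {suc _} _   true  = refl
∣0-or-±1∣≡1 {suc _} _   false = refl

∣kroneckerPrime∣≡1 : ∀ {a q} .{{_ : NonZero q}} → ¬ q ∣ a → ∣ kroneckerPrime a q ∣ ≡ 1
∣kroneckerPrime∣≡1 {a} {1}                       1∤a = contradiction (1∣ a) 1∤a
∣kroneckerPrime∣≡1 {a} {2}                       2∤a = ∣0-or-±1∣≡1 (2∤a ∘ m%n≡0⇒n∣m a 2) _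
∣kroneckerPrime∣≡1 {a} {q@(suc (suc (suc _)))} q∤a = ∣0-or-±1∣≡1 (q∤a ∘ m%n≡0⇒n∣m a q) _

pow≡1+[x-1]*geom : ∀ x e → x ℤ.^ suc e ≡ + 1 ℤ.+ (x ℤ.- + 1) ℤ.* geom x e
pow≡1+[x-1]*geom x zero    = base x
  where
  base : ∀ x → x ℤ.* + 1 ≡ + 1 ℤ.+ (x ℤ.- + 1) ℤ.* + 1
  base = solve-∀
pow≡1+[x-1]*geom x (suc e) = trans (cong (x ℤ.*_) (pow≡1+[x-1]*geom x e)) (step x (geom x e))
  where
  step : ∀ x g → x ℤ.* (+ 1 ℤ.+ (x ℤ.- + 1) ℤ.* g) ≡ + 1 ℤ.+ (x ℤ.- + 1) ℤ.* (+ 1 ℤ.+ x ℤ.* g)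
  step = solve-∀

∣i^n∣≡∣i∣^n : ∀ i n → ∣ i ℤ.^ n ∣ ≡ ∣ i ∣ ^ n
∣i^n∣≡∣i∣^n i zero    = refl
∣i^n∣≡∣i∣^n i (suc n) = trans (ℤₚ.abs-* i (i ℤ.^ n)) (cong (∣ i ∣ *_) (∣i^n∣≡∣i∣^n i n))

q*a≤1+[q+1]*u⇒a≤2*u : ∀ q a u → 2 ≤ q → 2 ≤ a → q * a ≤ 1 + (q + 1) * u → a ≤ 2 * u
q*a≤1+[q+1]*u⇒a≤2*u q a u 2≤q 2≤a qa≤ = *-cancelˡ-≤ (q + 1) (+-cancelʳ-≤ 2 _ _ (begin
  (q + 1) * a + 2        ≡⟨ expand q a ⟩
  q * a + (a + 2)        ≤⟨ +-monoʳ-≤ (q * a) a+2≤qa ⟩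
  q * a + q * a          ≤⟨ +-mono-≤ qa≤ qa≤ ⟩
  (1 + (q + 1) * u) + (1 + (q + 1) * u) ≡⟨ collect q u ⟩
  (q + 1) * (2 * u) + 2  ∎))
  where
  open ≤-Reasoning
  instance _ = ℕ.>-nonZero (m≤n+m 1 q)
  expand : ∀ q a → (q + 1) * a + 2 ≡ q * a + (a + 2)
  expand = ℕ-Solver.solve-∀
  collect : ∀ q u → (1 + (q + 1) * u) + (1 + (q + 1) * u) ≡ (q + 1) * (2 * u) + 2
  collect = ℕ-Solver.solve-∀
  a+2≤qa : a + 2 ≤ q * a
  a+2≤qa = begin
    a + 2  ≤⟨ +-monoʳ-≤ a 2≤a ⟩
    a + a  ≡⟨ cong (_+_ a) (+-identityʳ a) ⟨
    2 * a  ≤⟨ *-monoˡ-≤ a 2≤q ⟩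
    q * a  ∎

geom-lower-bound : ∀ x q e → 2 ≤ q → ∣ x ∣ ≡ q → q ^ suc e ≤ 2 * ∣ geom x (suc e) ∣
geom-lower-bound x q e 2≤q ∣x∣≡q = q*a≤1+[q+1]*u⇒a≤2*u q (q ^ suc e) u 2≤q 2≤q^[1+e] (begin
  q * q ^ suc e                              ≡⟨ cong (_^ suc (suc e)) ∣x∣≡q ⟨
  ∣ x ∣ ^ suc (suc e)                        ≡⟨ ∣i^n∣≡∣i∣^n x (suc (suc e)) ⟨
  ∣ x ℤ.^ suc (suc e) ∣                      ≡⟨ cong ∣_∣ (pow≡1+[x-1]*geom x (suc e)) ⟩
  ∣ + 1 ℤ.+ (x ℤ.- + 1) ℤ.* geom x (suc e) ∣ ≤⟨ ℤₚ.∣i+j∣≤∣i∣+∣j∣ (+ 1) ((x ℤ.- + 1) ℤ.* geom x (suc e)) ⟩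
  1 + ∣ (x ℤ.- + 1) ℤ.* geom x (suc e) ∣     ≡⟨ cong (_+_ 1) (ℤₚ.abs-* (x ℤ.- + 1) _) ⟩
  1 + ∣ x ℤ.- + 1 ∣ * u                      ≤⟨ +-monoʳ-≤ 1 (*-monoˡ-≤ u ∣x-1∣≤q+1) ⟩
  1 + (q + 1) * u                            ∎)
  where
  open ≤-Reasoning
  u : ℕ
  u = ∣ geom x (suc e) ∣
  ∣x-1∣≤q+1 : ∣ x ℤ.- + 1 ∣ ≤ q + 1
  ∣x-1∣≤q+1 = subst (λ y → ∣ x ℤ.- + 1 ∣ ≤ y + 1) ∣x∣≡q (ℤₚ.∣i-j∣≤∣i∣+∣j∣ x (+ 1))
  2≤q^[1+e] : 2 ≤ q ^ suc e
  2≤q^[1+e] = ≤-trans 2≤q (m≤m*n q (q ^ e) {{m^n≢0 q e {{ℕ.>-nonZero (≤-trans z<s 2≤q)}}}})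

isPrimeDivisor : ℕ → ℕ → ℕ
isPrimeDivisor n r = if does (prime? r) then (if does (r ∣? n) then 1 else 0) else 0

omega≡foldRange : ∀ n → omega n ≡ Σℕ.foldRange (isPrimeDivisor n) n
omega≡foldRange n = begin
  length (filter (λ r → r ∣? n) (primesUpTo n))
    ≡⟨ length≡fold (filter (λ r → r ∣? n) (primesUpTo n)) ⟩
  Σℕ.fold (λ _ → 1) (filter (λ r → r ∣? n) (primesUpTo n))
    ≡⟨ Σℕ.fold-filter (λ r → r ∣? n) _ (primesUpTo n) ⟩
  Σℕ.fold (λ r → if does (r ∣? n) then 1 else 0) (primesUpTo n)
    ≡⟨ Σℕ.fold-filter (λ r → prime? r) _ (range1 n) ⟩
  Σℕ.fold (isPrimeDivisor n) (range1 n)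
    ≡⟨ Σℕ.fold-range1 (isPrimeDivisor n) n ⟩
  Σℕ.foldRange (isPrimeDivisor n) n
    ∎
  where
  open ≡-Reasoning
  length≡fold : ∀ xs → length xs ≡ Σℕ.fold (λ _ → 1) xs
  length≡fold []       = refl
  length≡fold (_ ∷ xs) = cong suc (length≡fold xs)

Σℕ-mono-≤ : ∀ h h' N → (∀ i → i < N → h (suc i) ≤ h' (suc i)) →
  Σℕ.foldRange h N ≤ Σℕ.foldRange h' N
Σℕ-mono-≤ h h' zero    _  = ≤-refl
Σℕ-mono-≤ h h' (suc N) le = +-mono-≤ (Σℕ-mono-≤ h h' N (λ i i<N → le i (m<n⇒m<1+n i<N))) (le N ≤-refl)

Σℕ-mono-< : ∀ h h' N q → (∀ i → i < N → h (suc i) ≤ h' (suc i)) → 1 ≤ q → q ≤ N → h q < h' q →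
  Σℕ.foldRange h N < Σℕ.foldRange h' N
Σℕ-mono-< h h' zero    q le 1≤q q≤0 _ = contradiction (≤-trans 1≤q q≤0) λ ()
Σℕ-mono-< h h' (suc N) q le 1≤q q≤N lt with q ≟ suc N
... | yes refl = +-mono-≤-< (Σℕ-mono-≤ h h' N (λ i i<N → le i (m<n⇒m<1+n i<N))) lt
... | no q≢1+N = +-mono-<-≤ (Σℕ-mono-< h h' N q (λ i i<N → le i (m<n⇒m<1+n i<N)) 1≤q
                               (≤-pred (≤∧≢⇒< q≤N q≢1+N)) lt) (le N ≤-refl)

omega-< : ∀ {q m n} → Prime q → q ∣ n → ¬ q ∣ m → m ∣ n → .{{_ : NonZero m}} → .{{_ : NonZero n}} →
  omega m < omega n
omega-< {q} {m} {n} pq q∣n q∤m m∣n = begin-strict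
  omega m                           ≡⟨ omega≡foldRange m ⟩
  Σℕ.foldRange (isPrimeDivisor m) m ≡⟨ Σℕ.foldRange-extend _ m n (∣⇒≤ m∣n) above-m ⟨
  Σℕ.foldRange (isPrimeDivisor m) n <⟨ Σℕ-mono-< _ _ n q (λ i _ → pointwise (suc i)) 1≤q (∣⇒≤ q∣n) at-q ⟩
  Σℕ.foldRange (isPrimeDivisor n) n ≡⟨ omega≡foldRange n ⟨
  omega n                           ∎
  where
  open ≤-Reasoning
  1≤q : 1 ≤ q
  1≤q = ℕ.>-nonZero⁻¹ q {{prime⇒nonZero pq}}
  above-m : ∀ r → m < r → isPrimeDivisor m r ≡ 0
  above-m r m<r with prime? r
  ... | no _ = refl
  ... | yes _ with r ∣? m
  ... | no _    = refl
  ... | yes r∣m = contradiction (∣⇒≤ r∣m) (<⇒≱ m<r)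
  pointwise : ∀ r → isPrimeDivisor m r ≤ isPrimeDivisor n r
  pointwise r with prime? r
  ... | no _ = ≤-refl
  ... | yes _ with r ∣? m | r ∣? n
  ... | yes _   | yes _   = ≤-refl
  ... | no _    | _       = z≤n
  ... | yes r∣m | no r∤n  = contradiction (∣-trans r∣m m∣n) r∤n
  at-q : isPrimeDivisor m q < isPrimeDivisor n q
  at-q with prime? q
  ... | no ¬pq = contradiction pq ¬pq
  ... | yes _ with q ∣? m | q ∣? n
  ... | yes q∣m | _       = contradiction q∣m q∤m
  ... | no _    | yes _   = ≤-refl
  ... | no _    | no q∤n  = contradiction q∣n q∤n

∃-prime-divisor : ∀ n → 2 ≤ n → ∃[ q ] Prime q × q ∣ n
∃-prime-divisor n 2≤n = go n 2≤n (<-wellFounded n)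
  where
  go : ∀ n → 2 ≤ n → Acc _<_ n → ∃[ q ] Prime q × q ∣ n
  go n 2≤n (acc rec) with composite? n
  ... | no ¬composite = n , prime {{ℕ.n>1⇒nonTrivial 2≤n}} ¬composite , ∣-refl
  ... | yes (hasNonTrivialDivisor {d} d<n d∣n) with go d (ℕ.nonTrivial⇒n>1 d) (rec d<n)
  ...   | q , pq , q∣d = q , pq , ∣-trans q∣d d∣n

prime^-decomposition : ∀ {q} n → Prime q → .{{_ : NonZero n}} → q ∣ n →
  ∃[ e ] ∃[ m ] n ≡ q ^ suc e * m × ¬ q ∣ m
prime^-decomposition {q} n pq = go n (<-wellFounded n)
  where
  instance _ = prime⇒nonZero pq
  go : ∀ n .{{_ : NonZero n}} → Acc _<_ n → q ∣ n → ∃[ e ] ∃[ m ] n ≡ q ^ suc e * m × ¬ q ∣ m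
  go n (acc rec) q∣n with q ∣? (n / q)
  ... | no q∤n/q = 0 , n / q , trans n≡q*[n/q] (cong (_* (n / q)) (sym (*-identityʳ q))) , q∤n/q
    where
    n≡q*[n/q] : n ≡ q * (n / q)
    n≡q*[n/q] = sym (m*[n/m]≡n q∣n)
  ... | yes q∣n/q with go (n / q) {{n/q≢0}} (rec (m/n<m n q (prime⇒>1 pq))) q∣n/q
    where
    n/q≢0 : NonZero (n / q)
    n/q≢0 = ℕ.>-nonZero (m≥n⇒m/n>0 (∣⇒≤ q∣n))
  ...   | e , m , n/q≡ , q∤m = suc e , m , n≡ , q∤m
    where
    open ≡-Reasoning
    n≡ : n ≡ q ^ suc (suc e) * m
    n≡ = begin
      n                     ≡⟨ m*[n/m]≡n q∣n ⟨
      q * (n / q)           ≡⟨ cong (q *_) n/q≡ ⟩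
      q * (q ^ suc e * m)   ≡⟨ *-assoc q (q ^ suc e) m ⟨
      q ^ suc (suc e) * m   ∎

m<q^[1+e]*m : ∀ {q m} e → Prime q → .{{_ : NonZero m}} → m < q ^ suc e * m
m<q^[1+e]*m {q} {m} e pq = subst (m <_) (*-comm m (q ^ suc e)) (m<m*n m (q ^ suc e) 1<q^[1+e])
  where
  1<q^[1+e] : 1 < q ^ suc e
  1<q^[1+e] = ≤-trans (prime⇒>1 pq) (m≤m*n q (q ^ e) {{m^n≢0 q e {{prime⇒nonZero pq}}}})

Bound : ℕ → ℕ → Set
Bound p n = n ≤ ∣ sigmaTilde p n ∣ * 2 ^ omega n

bound-prime^* : ∀ {p q m} e → Prime q → ¬ q ∣ p → ¬ q ∣ m → .{{_ : NonZero m}} →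
  Bound p m → Bound p (q ^ suc e * m)
bound-prime^* {p} {q} {m} e pq q∤p q∤m bound-m = begin
  q ^ suc e * m
    ≤⟨ *-mono-≤ (geom-lower-bound x q e 2≤q ∣x∣≡q) bound-m ⟩
  (2 * ∣ G ∣) * (∣ sigmaTilde p m ∣ * 2 ^ omega m)
    ≡⟨ rearrange ∣ G ∣ ∣ sigmaTilde p m ∣ (2 ^ omega m) ⟩
  (∣ sigmaTilde p m ∣ * ∣ G ∣) * 2 ^ suc (omega m)
    ≤⟨ *-monoʳ-≤ (∣ sigmaTilde p m ∣ * ∣ G ∣) (^-monoʳ-≤ 2 ω-grows) ⟩
  (∣ sigmaTilde p m ∣ * ∣ G ∣) * 2 ^ omega n
    ≡⟨ cong (_* 2 ^ omega n) ∣σn∣ ⟨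
  ∣ sigmaTilde p n ∣ * 2 ^ omega n
    ∎
  where
  open ≤-Reasoning
  n : ℕ
  n = q ^ suc e * m
  x G : ℤ
  x = kroneckerPrime p q ℤ.* + q
  G = geom x (suc e)
  instance _ = prime⇒nonZero pq
  instance _ = m*n≢0 (q ^ suc e) m {{m^n≢0 q (suc e)}}
  2≤q : 2 ≤ q
  2≤q = prime⇒>1 pq
  ∣x∣≡q : ∣ x ∣ ≡ q
  ∣x∣≡q = trans (ℤₚ.abs-* (kroneckerPrime p q) (+ q))
                (trans (cong (_* q) (∣kroneckerPrime∣≡1 q∤p)) (*-identityˡ q))
  ∣σn∣ : ∣ sigmaTilde p n ∣ ≡ ∣ sigmaTilde p m ∣ * ∣ G ∣
  ∣σn∣ = trans (cong ∣_∣ (sigmaTilde-prime^ p q m pq q∤m (suc e))) (ℤₚ.abs-* (sigmaTilde p m) G)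
  ω-grows : suc (omega m) ≤ omega n
  ω-grows = omega-< pq (∣-trans (m∣m*n (q ^ e)) (m∣m*n m)) q∤m (n∣m*n (q ^ suc e))
  rearrange : ∀ g s t → (2 * g) * (s * t) ≡ (s * g) * (2 * t)
  rearrange = ℕ-Solver.solve-∀

proposition3 : (p n : ℕ) → Prime p → NonZero n → ¬ (p ∣ n) →
    n ≤ ∣ sigmaTilde p n ∣ * 2 ^ omega n
proposition3 p n pp n≢0 p∤n = go n n≢0 p∤n (<-wellFounded n)
  where
  go : ∀ n → NonZero n → ¬ p ∣ n → Acc _<_ n → Bound p n
  go 1 _ _ _ = ≤-refl
  go n@(suc (suc _)) n≢0 p∤n (acc rec) with ∃-prime-divisor n (s≤s (s≤s z≤n))
  ... | q , pq , q∣n with prime^-decomposition n pq q∣n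
  ...   | e , m , n≡ , q∤m =
    subst (Bound p) (sym n≡) (bound-prime^* e pq q∤p q∤m {{m≢0}} (go m m≢0 p∤m (rec m<n)))
    where
    q∤p : ¬ q ∣ p
    q∤p q∣p = p∤n (subst (_∣ n) (prime∣prime⇒≡ pq pp q∣p) q∣n)
    m≢0 : NonZero m
    m≢0 = m*n≢0⇒n≢0 (q ^ suc e) {{subst NonZero n≡ n≢0}}
    m∣n : m ∣ n
    m∣n = subst (m ∣_) (sym n≡) (n∣m*n (q ^ suc e))
    p∤m : ¬ p ∣ m
    p∤m p∣m = p∤n (∣-trans p∣m m∣n)
    m<n : m < n
    m<n = subst (m <_) (sym n≡) (m<q^[1+e]*m e pq {{m≢0}})
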